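{- Let $k,\ell,b,n_1,n_2$ be positive integers with $k,\ell\leq b$, $2(k+b)<n_1$, $2(\ell+b)<n_2$. Let $\mathcal{R}$ be a proj-intersecting family of $k\times\ell$ rectangles in $\mathbb{Z}_{n_1}\times\mathbb{Z}_{n_2}$. Suppose that $\mathcal{R}$ contains $\ell$ $b$-blocking pairs (of the form $I_1\times J_0, I_2\times J_0$ with $d(I_1,I_2)\geq b+1$) with pairwise distinct bases. Then there is $\beta\in\mathbb{Z}_{n_2}$ such that for every member $I\times J$ of $\mathcal{R}$ we have $\beta\in J$.
   Context: For $u,v\in\mathbb{Z}_n$ the distance $d(u,v)$ is the smaller of $(u-v)\bmod n$ and $(v-u)\bmod n$. An interval of length $a$ in $\mathbb{Z}_n$ is a set $\{i+1,\ldots,i+a\}$ (mod $n$); the distance of two intervals is the minimum distance between an element of one and an element of the other. A $k\times\ell$ rectangle is $I\times J$ with $I$ an interval of length $k$ in $\mathbb{Z}_{n_1}$ and $J$ an interval of length $\ell$ in $\mathbb{Z}_{n_2}$. Rectangles $I\times J$, $I'\times J'$ are proj-intersecting if $I\cap I'\neq\emptyset$ or $J\cap J'\neq\emptyset$; a family is proj-intersecting if every two members are. Two rectangles $R_1=I_1\times J_0$, $R_2=I_2\times J_0$ with $d(I_1,I_2)\geq b+1$ form a $b$-blocking pair with base $J_0$. -}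

module Defs where

open import Data.Nat using (ℕ; suc; _+_; _∸_; _≤_; NonZero; _⊓_)
open import Data.Nat.DivMod using (_%_)
open import Data.Fin using (Fin; toℕ)
open import Data.Product using (Σ; _×_; _,_; ∃; ∃-syntax)
open import Data.Sum using (_⊎_)
open import Relation.Binary.PropositionalEquality using (_≡_)

-- Elements of ℤ_n are represented by Fin n (toℕ gives the residue in [0,n)).

modDiff : {n : ℕ} .{{_ : NonZero n}} → Fin n → Fin n → ℕ
modDiff {n} u v = (toℕ u + n ∸ toℕ v) % n

dist : {n : ℕ} .{{_ : NonZero n}} → Fin n → Fin n → ℕ
dist u v = modDiff u v ⊓ modDiff v u

-- The interval of length a with parameter i is {i+1, …, i+a} (mod n).
-- x lies in it iff x ≡ i + t (mod n) for some 1 ≤ t ≤ a.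
InInterval : {n : ℕ} .{{_ : NonZero n}} → Fin n → (i : Fin n) (a : ℕ) → Set
InInterval {n} x i a = ∃[ t ] (1 ≤ t × t ≤ a × toℕ x ≡ (toℕ i + t) % n)

-- Distance of two intervals is ≥ c: every element of one is at distance
-- ≥ c from every element of the other (i.e. the minimum distance is ≥ c;
-- intervals considered here are nonempty).
IntervalDistGE : {n : ℕ} .{{_ : NonZero n}} →
                 (i₁ : Fin n) (a₁ : ℕ) (i₂ : Fin n) (a₂ : ℕ) (c : ℕ) → Set
IntervalDistGE {n} i₁ a₁ i₂ a₂ c =
  (u v : Fin n) → InInterval u i₁ a₁ → InInterval v i₂ a₂ → c ≤ dist u v

-- A k×ℓ rectangle I × J in ℤ_{n₁} × ℤ_{n₂} is given by the parameters
-- (i , j) of its intervals I = {i+1..i+k}, J = {j+1..j+ℓ}.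
Rect : ℕ → ℕ → Set
Rect n₁ n₂ = Fin n₁ × Fin n₂

Family : ℕ → ℕ → Set₁
Family n₁ n₂ = Rect n₁ n₂ → Set

IntervalsMeet : {n : ℕ} .{{_ : NonZero n}} → Fin n → Fin n → ℕ → Set
IntervalsMeet {n} i i' a = ∃[ x ] (InInterval x i a × InInterval x i' a)

ProjIntersecting : {n₁ n₂ : ℕ} .{{_ : NonZero n₁}} .{{_ : NonZero n₂}} →
                   (k ℓ : ℕ) → Family n₁ n₂ → Set
ProjIntersecting {n₁} {n₂} k ℓ R =
  (i i' : Fin n₁) (j j' : Fin n₂) → R (i , j) → R (i' , j') →
  IntervalsMeet i i' k ⊎ IntervalsMeet j j' ℓ

HasBlockingPair : {n₁ n₂ : ℕ} .{{_ : NonZero n₁}} .{{_ : NonZero n₂}} →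
                  (k ℓ b : ℕ) → Family n₁ n₂ → Fin n₂ → Set
HasBlockingPair {n₁} {n₂} k ℓ b R j₀ =
  ∃[ i₁ ] ∃[ i₂ ] (R (i₁ , j₀) × R (i₂ , j₀) × IntervalDistGE i₁ k i₂ k (suc b))

-- A member I × J meets each rectangle I₁ × J₀, I₂ × J₀ of a blocking pair in some
-- projection. I cannot meet both I₁ and I₂, as two points of an interval of length
-- k ≤ b are closer than b + 1; so J meets J₀. Hence every such J, the bases included,
-- meets all ℓ bases. Measure ℤ_{n₂} from ρ = s₀ − ℓ for one base s₀: every such
-- interval then starts at height < 2ℓ, so (as 3ℓ ≤ n₂) nothing wraps around and two
-- meeting intervals have heights differing by less than ℓ. The ℓ distinct bases thus
-- occupy the heights μ, …, μ + ℓ − 1, and any J meeting all of them has height in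
-- [μ, μ + ℓ − 1], hence contains β = ρ + μ + ℓ.
module Submission where

open import Defs
open import Data.Nat using (ℕ; zero; suc; _+_; _*_; _∸_; _≤_; _<_; NonZero; _≤?_)
open import Data.Nat.Properties
open import Data.Nat.DivMod
  using (_%_; _mod_; m%n<n; m<n⇒m%n≡m; m%n%n≡m%n; [m+n]%n≡m%n; %-distribˡ-+)
open import Data.Fin using (Fin; toℕ; fromℕ<)
open import Data.Fin.Properties using (toℕ-injective; toℕ-fromℕ<; toℕ<n; injective⇒≤; any?)
open import Data.Product using (_×_; _,_; ∃₂; ∃-syntax; proj₁; proj₂)
open import Data.Sum using (inj₁; inj₂)
open import Function using (_∘_)
open import Function.Definitions using (Injective)
open import Relation.Nullary using (yes; no; contradiction)
open import Relation.Binary.PropositionalEquality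
open import Algebra.Properties.CommutativeSemigroup +-commutativeSemigroup using (x∙yz≈y∙xz)

[m%d+n]%d≡[m+n]%d : ∀ m n d .{{_ : NonZero d}} → (m % d + n) % d ≡ (m + n) % d
[m%d+n]%d≡[m+n]%d m n d = begin
  (m % d + n) % d          ≡⟨ %-distribˡ-+ (m % d) n d ⟩
  (m % d % d + n % d) % d  ≡⟨ cong (λ x → (x + n % d) % d) (m%n%n≡m%n m d) ⟩
  (m % d + n % d) % d      ≡⟨ %-distribˡ-+ m n d ⟨
  (m + n) % d              ∎
  where open ≡-Reasoning

[m+n%d]%d≡[m+n]%d : ∀ m n d .{{_ : NonZero d}} → (m + n % d) % d ≡ (m + n) % d
[m+n%d]%d≡[m+n]%d m n d = begin
  (m + n % d) % d  ≡⟨ cong (_% d) (+-comm m (n % d)) ⟩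
  (n % d + m) % d  ≡⟨ [m%d+n]%d≡[m+n]%d n m d ⟩
  (n + m) % d      ≡⟨ cong (_% d) (+-comm n m) ⟩
  (m + n) % d      ∎
  where open ≡-Reasoning

argmin : ∀ {m} (f : Fin (suc m) → ℕ) → ∃[ i ] (∀ j → f i ≤ f j)
argmin {zero} f = Fin.zero , λ { Fin.zero → ≤-refl }
argmin {suc m} f with argmin (f ∘ Fin.suc)
... | i , f-min with f Fin.zero ≤? f (Fin.suc i)
... | yes p = Fin.zero , λ { Fin.zero → ≤-refl ; (Fin.suc j) → ≤-trans p (f-min j) }
... | no p = Fin.suc i , λ { Fin.zero → <⇒≤ (≰⇒> p) ; (Fin.suc j) → f-min j }

injective-spread : ∀ {m} (f : Fin (suc m) → ℕ) → Injective _≡_ _≡_ f →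
                   ∃₂ λ i j → f i + m ≤ f j
injective-spread {m} f f-injective with argmin f
... | i , f-min with any? (λ j → f i + m ≤? f j)
... | yes (j , f-far) = i , j , f-far
... | no no-far = contradiction (injective⇒≤ g-injective) 1+n≰n
  where
  below : ∀ j → f j ∸ f i < m
  below j = subst (f j ∸ f i <_) (m+n∸m≡n (f i) m)
                  (∸-monoˡ-< (≰⇒> (λ far → no-far (j , far))) (f-min j))
  g : Fin (suc m) → Fin m
  g j = fromℕ< (below j)
  g-injective : Injective _≡_ _≡_ g
  g-injective {j} {j′} e = f-injective (∸-cancelʳ-≡ (f-min j) (f-min j′)
    (trans (sym (toℕ-fromℕ< (below j))) (trans (cong toℕ e) (toℕ-fromℕ< (below j′)))))

module _ {n : ℕ} .{{_ : NonZero n}} where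

  infixl 6 _⊕_
  _⊕_ : Fin n → ℕ → Fin n
  i ⊕ t = (toℕ i + t) mod n

  toℕ-⊕ : ∀ i t → toℕ (i ⊕ t) ≡ (toℕ i + t) % n
  toℕ-⊕ i t = toℕ-fromℕ< (m%n<n (toℕ i + t) n)

  ⊕-assoc : ∀ i s t → i ⊕ s ⊕ t ≡ i ⊕ (s + t)
  ⊕-assoc i s t = toℕ-injective (begin
    toℕ (i ⊕ s ⊕ t)            ≡⟨ toℕ-⊕ (i ⊕ s) t ⟩
    (toℕ (i ⊕ s) + t) % n      ≡⟨ cong (λ x → (x + t) % n) (toℕ-⊕ i s) ⟩
    ((toℕ i + s) % n + t) % n  ≡⟨ [m%d+n]%d≡[m+n]%d (toℕ i + s) t n ⟩
    (toℕ i + s + t) % n        ≡⟨ cong (_% n) (+-assoc (toℕ i) s t) ⟩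
    (toℕ i + (s + t)) % n      ≡⟨ toℕ-⊕ i (s + t) ⟨
    toℕ (i ⊕ (s + t))          ∎)
    where open ≡-Reasoning

  ⊕-% : ∀ i t → i ⊕ t % n ≡ i ⊕ t
  ⊕-% i t = toℕ-injective (begin
    toℕ (i ⊕ t % n)        ≡⟨ toℕ-⊕ i (t % n) ⟩
    (toℕ i + t % n) % n    ≡⟨ [m+n%d]%d≡[m+n]%d (toℕ i) t n ⟩
    (toℕ i + t) % n        ≡⟨ toℕ-⊕ i t ⟨
    toℕ (i ⊕ t)            ∎)
    where open ≡-Reasoning

  ⊕-period : ∀ i → i ⊕ n ≡ i
  ⊕-period i = toℕ-injective (begin
    toℕ (i ⊕ n)      ≡⟨ toℕ-⊕ i n ⟩
    (toℕ i + n) % n  ≡⟨ [m+n]%n≡m%n (toℕ i) n ⟩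
    toℕ i % n        ≡⟨ m<n⇒m%n≡m (toℕ<n i) ⟩
    toℕ i            ∎)
    where open ≡-Reasoning

  ⊕-inverseʳ : ∀ i {t} → t ≤ n → i ⊕ t ⊕ (n ∸ t) ≡ i
  ⊕-inverseʳ i {t} t≤n = begin
    i ⊕ t ⊕ (n ∸ t)    ≡⟨ ⊕-assoc i t (n ∸ t) ⟩
    i ⊕ (t + (n ∸ t))  ≡⟨ cong (i ⊕_) (m+[n∸m]≡n t≤n) ⟩
    i ⊕ n              ≡⟨ ⊕-period i ⟩
    i                  ∎
    where open ≡-Reasoning

  ⊕-cancelʳ : ∀ {i j t} → t ≤ n → i ⊕ t ≡ j ⊕ t → i ≡ j
  ⊕-cancelʳ {i} {j} {t} t≤n e =
    trans (sym (⊕-inverseʳ i t≤n)) (trans (cong (_⊕ (n ∸ t)) e) (⊕-inverseʳ j t≤n))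

  toℕ-⊕-rewind : ∀ i {s} → s < n → toℕ (i ⊕ s ⊕ (n ∸ toℕ i)) ≡ s
  toℕ-⊕-rewind i {s} s<n = begin
    toℕ (i ⊕ s ⊕ (n ∸ toℕ i))          ≡⟨ cong toℕ (⊕-assoc i s (n ∸ toℕ i)) ⟩
    toℕ (i ⊕ (s + (n ∸ toℕ i)))        ≡⟨ toℕ-⊕ i (s + (n ∸ toℕ i)) ⟩
    (toℕ i + (s + (n ∸ toℕ i))) % n    ≡⟨ cong (_% n) (x∙yz≈y∙xz (toℕ i) s (n ∸ toℕ i)) ⟩
    (s + (toℕ i + (n ∸ toℕ i))) % n    ≡⟨ cong (λ x → (s + x) % n) (m+[n∸m]≡n (<⇒≤ (toℕ<n i))) ⟩
    (s + n) % n                        ≡⟨ [m+n]%n≡m%n s n ⟩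
    s % n                              ≡⟨ m<n⇒m%n≡m s<n ⟩
    s                                  ∎
    where open ≡-Reasoning

  ⊕-cancelˡ : ∀ i {s t} → s < n → t < n → i ⊕ s ≡ i ⊕ t → s ≡ t
  ⊕-cancelˡ i s<n t<n e = trans (sym (toℕ-⊕-rewind i s<n))
    (trans (cong (λ x → toℕ (x ⊕ (n ∸ toℕ i))) e) (toℕ-⊕-rewind i t<n))

  modDiff<n : ∀ u v → modDiff u v < n
  modDiff<n u v = m%n<n (toℕ u + n ∸ toℕ v) n

  ⊕-modDiff : ∀ u v → v ⊕ modDiff u v ≡ u
  ⊕-modDiff u v = trans (⊕-% v (toℕ u + n ∸ toℕ v)) (toℕ-injective (begin
    toℕ (v ⊕ (toℕ u + n ∸ toℕ v))        ≡⟨ toℕ-⊕ v (toℕ u + n ∸ toℕ v) ⟩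
    (toℕ v + (toℕ u + n ∸ toℕ v)) % n    ≡⟨ cong (_% n) (m+[n∸m]≡n v≤u+n) ⟩
    (toℕ u + n) % n                      ≡⟨ [m+n]%n≡m%n (toℕ u) n ⟩
    toℕ u % n                            ≡⟨ m<n⇒m%n≡m (toℕ<n u) ⟩
    toℕ u                                ∎))
    where
    open ≡-Reasoning
    v≤u+n : toℕ v ≤ toℕ u + n
    v≤u+n = ≤-trans (<⇒≤ (toℕ<n v)) (m≤n+m n (toℕ u))

  modDiff-⊕ : ∀ v {t} → t < n → modDiff (v ⊕ t) v ≡ t
  modDiff-⊕ v {t} t<n = ⊕-cancelˡ v (modDiff<n (v ⊕ t) v) t<n (⊕-modDiff (v ⊕ t) v)

  modDiff-⊕-⊕ : ∀ i {s t} → s ≤ t → t < n → modDiff (i ⊕ t) (i ⊕ s) ≡ t ∸ s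
  modDiff-⊕-⊕ i {s} {t} s≤t t<n = begin
    modDiff (i ⊕ t) (i ⊕ s)             ≡⟨ cong (λ x → modDiff (i ⊕ x) (i ⊕ s)) (m+[n∸m]≡n s≤t) ⟨
    modDiff (i ⊕ (s + (t ∸ s))) (i ⊕ s)  ≡⟨ cong (λ x → modDiff x (i ⊕ s)) (⊕-assoc i s (t ∸ s)) ⟨
    modDiff (i ⊕ s ⊕ (t ∸ s)) (i ⊕ s)    ≡⟨ modDiff-⊕ (i ⊕ s) (≤-<-trans (m∸n≤m t s) t<n) ⟩
    t ∸ s                                ∎
    where open ≡-Reasoning

  ⊕∈interval : ∀ i {t a} → 1 ≤ t → t ≤ a → InInterval (i ⊕ t) i a
  ⊕∈interval i {t} 1≤t t≤a = t , 1≤t , t≤a , toℕ-⊕ i t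

  ∈interval⇒⊕ : ∀ {x i a} → InInterval x i a → ∃[ t ] (1 ≤ t × t ≤ a × x ≡ i ⊕ t)
  ∈interval⇒⊕ {i = i} (t , 1≤t , t≤a , e) =
    t , 1≤t , t≤a , toℕ-injective (trans e (sym (toℕ-⊕ i t)))

  intervalsMeet-sym : ∀ {i i′ a} → IntervalsMeet i i′ a → IntervalsMeet i′ i a
  intervalsMeet-sym (x , x∈i , x∈i′) = x , x∈i′ , x∈i

  dist-<-interval : ∀ {x y i k} → k < n → InInterval x i k → InInterval y i k → dist x y < k
  dist-<-interval {i = i} k<n x∈i y∈i with ∈interval⇒⊕ x∈i | ∈interval⇒⊕ y∈i
  ... | t , 1≤t , t≤k , refl | s , 1≤s , s≤k , refl with s ≤? t
  ... | yes s≤t = ≤-<-trans (m⊓n≤m _ _) (subst (_< _) (sym (modDiff-⊕-⊕ i s≤t (≤-<-trans t≤k k<n)))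
                    (<-≤-trans (∸-monoʳ-< 1≤s s≤t) t≤k))
  ... | no s≰t = ≤-<-trans (m⊓n≤n _ _) (subst (_< _) (sym (modDiff-⊕-⊕ i t≤s (≤-<-trans s≤k k<n)))
                    (<-≤-trans (∸-monoʳ-< 1≤t t≤s) s≤k))
    where
    t≤s : t ≤ s
    t≤s = <⇒≤ (≰⇒> s≰t)

  -- The offset is a + t₂ ∸ t₁, where the meeting point is p ⊕ t₁ = q ⊕ a ⊕ t₂.
  meet-offset : ∀ {p q a} → a + a ≤ n → IntervalsMeet p (q ⊕ a) a → modDiff p q < a + a
  meet-offset {p} {q} {a} 2a≤n (x , x∈p , x∈qa) with ∈interval⇒⊕ x∈p | ∈interval⇒⊕ x∈qa
  ... | t₁ , 1≤t₁ , t₁≤a , refl | t₂ , _ , t₂≤a , x≡ =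
    subst (λ y → modDiff y q < a + a) (sym p≡q⊕c) (subst (_< a + a) (sym (modDiff-⊕ q c<n)) c<2a)
    where
    c : ℕ
    c = a + t₂ ∸ t₁
    c+t₁≡ : c + t₁ ≡ a + t₂
    c+t₁≡ = m∸n+n≡m (≤-trans t₁≤a (m≤m+n a t₂))
    c<2a : c < a + a
    c<2a = <-≤-trans (m<m+n c 1≤t₁) (≤-trans (≤-reflexive c+t₁≡) (+-monoʳ-≤ a t₂≤a))
    c<n : c < n
    c<n = <-≤-trans c<2a 2a≤n
    p≡q⊕c : p ≡ q ⊕ c
    p≡q⊕c = ⊕-cancelʳ (≤-trans t₁≤a (≤-trans (m≤m+n a a) 2a≤n)) (begin
      p ⊕ t₁        ≡⟨ x≡ ⟩
      q ⊕ a ⊕ t₂    ≡⟨ ⊕-assoc q a t₂ ⟩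
      q ⊕ (a + t₂)  ≡⟨ cong (q ⊕_) c+t₁≡ ⟨
      q ⊕ (c + t₁)  ≡⟨ ⊕-assoc q c t₁ ⟨
      q ⊕ c ⊕ t₁    ∎)
      where open ≡-Reasoning

  meet-offset-< : ∀ q {c c′ a} → c + a < n → c′ + a < n →
                  IntervalsMeet (q ⊕ c) (q ⊕ c′) a → c < c′ + a
  meet-offset-< q {c} {c′} {a} c+a<n c′+a<n (x , x∈qc , x∈qc′)
    with ∈interval⇒⊕ x∈qc | ∈interval⇒⊕ x∈qc′
  ... | t₁ , 1≤t₁ , t₁≤a , refl | t₂ , _ , t₂≤a , x≡ =
    <-≤-trans (m<m+n c 1≤t₁) (≤-trans (≤-reflexive c+t₁≡c′+t₂) (+-monoʳ-≤ c′ t₂≤a))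
    where
    c+t₁≡c′+t₂ : c + t₁ ≡ c′ + t₂
    c+t₁≡c′+t₂ = ⊕-cancelˡ q (≤-<-trans (+-monoʳ-≤ c t₁≤a) c+a<n)
                             (≤-<-trans (+-monoʳ-≤ c′ t₂≤a) c′+a<n)
      (trans (sym (⊕-assoc q c t₁)) (trans x≡ (⊕-assoc q c′ t₂)))

module _ {n₁ n₂ : ℕ} .{{_ : NonZero n₁}} .{{_ : NonZero n₂}} {k ℓ b : ℕ} {R : Family n₁ n₂} where

  blockingPair⇒meetsBase : k < n₁ → k ≤ b → ProjIntersecting k ℓ R →
                           ∀ {i j j₀} → HasBlockingPair k ℓ b R j₀ → R (i , j) →
                           IntervalsMeet j j₀ ℓ
  blockingPair⇒meetsBase k<n₁ k≤b R-proj {i} {j} {j₀} (i₁ , i₂ , r₁ , r₂ , far) r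
    with R-proj i i₁ j j₀ r r₁ | R-proj i i₂ j j₀ r r₂
  ... | inj₂ meet | _ = meet
  ... | inj₁ _ | inj₂ meet = meet
  ... | inj₁ (x , x∈I , x∈I₁) | inj₁ (y , y∈I , y∈I₂) = contradiction
    (<-≤-trans (dist-<-interval k<n₁ x∈I y∈I) (≤-trans k≤b (≤-trans (n≤1+n b) (far x y x∈I₁ y∈I₂))))
    (<-irrefl refl)

module CommonPoint {n : ℕ} .{{_ : NonZero n}} (ℓ′ : ℕ)
  (3ℓ≤n : suc ℓ′ + suc ℓ′ + suc ℓ′ ≤ n)
  (base : Fin (suc ℓ′) → Fin n) (base-injective : Injective _≡_ _≡_ base)
  (bases-meet : ∀ t u → IntervalsMeet (base t) (base u) (suc ℓ′)) where

  ℓ : ℕ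
  ℓ = suc ℓ′

  MeetsAllBases : Fin n → Set
  MeetsAllBases j = ∀ t → IntervalsMeet j (base t) ℓ

  2ℓ≤n : ℓ + ℓ ≤ n
  2ℓ≤n = ≤-trans (m≤m+n (ℓ + ℓ) ℓ) 3ℓ≤n

  s₀ : Fin n
  s₀ = base Fin.zero

  origin : Fin n
  origin = s₀ ⊕ (n ∸ ℓ)

  origin⊕ℓ : origin ⊕ ℓ ≡ s₀
  origin⊕ℓ = begin
    s₀ ⊕ (n ∸ ℓ) ⊕ ℓ    ≡⟨ ⊕-assoc s₀ (n ∸ ℓ) ℓ ⟩
    s₀ ⊕ (n ∸ ℓ + ℓ)    ≡⟨ cong (s₀ ⊕_) (m∸n+n≡m (≤-trans (m≤m+n ℓ ℓ) 2ℓ≤n)) ⟩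
    s₀ ⊕ n              ≡⟨ ⊕-period s₀ ⟩
    s₀                  ∎
    where open ≡-Reasoning

  height : Fin n → ℕ
  height j = modDiff j origin

  height-injective : Injective _≡_ _≡_ height
  height-injective {j} {j′} e =
    trans (sym (⊕-modDiff j origin)) (trans (cong (origin ⊕_) e) (⊕-modDiff j′ origin))

  height-< : ∀ {j} → IntervalsMeet j s₀ ℓ → height j < ℓ + ℓ
  height-< meet = meet-offset 2ℓ≤n (subst (λ s → IntervalsMeet _ s ℓ) (sym origin⊕ℓ) meet)

  height-close : ∀ {j j′} → IntervalsMeet j j′ ℓ → height j < ℓ + ℓ → height j′ < ℓ + ℓ →
                 height j < height j′ + ℓ
  height-close {j} {j′} meet h< h′< = meet-offset-< origin (below h<) (below h′<)
    (subst₂ (λ x y → IntervalsMeet x y ℓ)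
            (sym (⊕-modDiff j origin)) (sym (⊕-modDiff j′ origin)) meet)
    where
    below : ∀ {c} → c < ℓ + ℓ → c + ℓ < n
    below c<2ℓ = <-≤-trans (+-monoˡ-< ℓ c<2ℓ) 3ℓ≤n

  base-height-< : ∀ t → height (base t) < ℓ + ℓ
  base-height-< t = height-< (bases-meet t Fin.zero)

  base-heights-spread : ∃₂ λ t u → height (base t) + ℓ′ ≤ height (base u)
  base-heights-spread = injective-spread (height ∘ base) (base-injective ∘ height-injective)

  low high : Fin ℓ
  low = proj₁ base-heights-spread
  high = proj₁ (proj₂ base-heights-spread)

  μ : ℕ
  μ = height (base low)

  β : Fin n
  β = origin ⊕ (μ + ℓ)

  β∈ : ∀ {j} → MeetsAllBases j → InInterval β j ℓ
  β∈ {j} meets = subst (λ x → InInterval x j ℓ) j⊕t≡β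
    (⊕∈interval j (m<n⇒0<n∸m c<μ+ℓ) t≤ℓ)
    where
    c : ℕ
    c = height j
    c<2ℓ : c < ℓ + ℓ
    c<2ℓ = height-< (meets Fin.zero)
    c<μ+ℓ : c < μ + ℓ
    c<μ+ℓ = height-close (meets low) c<2ℓ (base-height-< low)
    μ≤c : μ ≤ c
    μ≤c = +-cancelʳ-≤ ℓ′ μ c (≤-pred (subst (suc (μ + ℓ′) ≤_) (+-suc c ℓ′)
      (≤-<-trans (proj₂ (proj₂ base-heights-spread))
                 (height-close (intervalsMeet-sym (meets high)) (base-height-< high) c<2ℓ))))
    t≤ℓ : μ + ℓ ∸ c ≤ ℓ
    t≤ℓ = ≤-trans (∸-monoʳ-≤ (μ + ℓ) μ≤c) (≤-reflexive (m+n∸m≡n μ ℓ))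
    j⊕t≡β : j ⊕ (μ + ℓ ∸ c) ≡ β
    j⊕t≡β = begin
      j ⊕ (μ + ℓ ∸ c)                ≡⟨ cong (_⊕ (μ + ℓ ∸ c)) (⊕-modDiff j origin) ⟨
      origin ⊕ c ⊕ (μ + ℓ ∸ c)       ≡⟨ ⊕-assoc origin c (μ + ℓ ∸ c) ⟩
      origin ⊕ (c + (μ + ℓ ∸ c))     ≡⟨ cong (origin ⊕_) (m+[n∸m]≡n (<⇒≤ c<μ+ℓ)) ⟩
      β                              ∎
      where open ≡-Reasoning

lemma5 : (k ℓ b n₁ n₂ : ℕ) .{{_ : NonZero n₁}} .{{_ : NonZero n₂}} →
         1 ≤ k → 1 ≤ ℓ → 1 ≤ b →
         k ≤ b → ℓ ≤ b → 2 * (k + b) < n₁ → 2 * (ℓ + b) < n₂ →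
         (R : Family n₁ n₂) → ProjIntersecting k ℓ R →
         (base : Fin ℓ → Fin n₂) → Injective _≡_ _≡_ base →
         ((t : Fin ℓ) → HasBlockingPair k ℓ b R (base t)) →
         ∃[ β ] ((i : Fin n₁) (j : Fin n₂) → R (i , j) → InInterval β j ℓ)
lemma5 k zero b n₁ n₂ _ () _ _ _ _ _ _ _ _ _ _
lemma5 k ℓ@(suc ℓ′) b n₁ n₂ _ _ _ k≤b ℓ≤b k-small ℓ-small R R-proj base base-injective pairs =
  β , λ i j r → β∈ (λ t → meetsBase (pairs t) r)
  where
  k<n₁ : k < n₁
  k<n₁ = ≤-<-trans (≤-trans (m≤m+n k b) (m≤m+n (k + b) _)) k-small
  3ℓ≤n₂ : ℓ + ℓ + ℓ ≤ n₂
  3ℓ≤n₂ = ≤-trans (+-mono-≤ (+-monoʳ-≤ ℓ ℓ≤b) (≤-trans (m≤m+n ℓ b) (m≤m+n (ℓ + b) 0)))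
                  (<⇒≤ ℓ-small)
  meetsBase : ∀ {i j j₀} → HasBlockingPair k ℓ b R j₀ → R (i , j) → IntervalsMeet j j₀ ℓ
  meetsBase = blockingPair⇒meetsBase k<n₁ k≤b R-proj
  bases-meet : ∀ t u → IntervalsMeet (base t) (base u) ℓ
  bases-meet t u with pairs t
  ... | _ , _ , r₁ , _ = meetsBase (pairs u) r₁
  open CommonPoint ℓ′ 3ℓ≤n₂ base base-injective bases-meet
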